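{- Let $(G,H)$ be dense and suppose $G$ has no $H$-orientation. Then every vertex $x$ of $G$ that is not a cut vertex has fixed parity, i.e., $H(x)\cap[0,d_G(x)]$ consists only of odd integers or only of even integers.
   Context: $G$ is a graph without loops, $H:V(G)\to 2^{\mathbb{N}}$. An $H$-orientation is an orientation $O$ of $G$ with out-degree $d^+_O(v)\in H(v)$ for all $v\in V(G)$. The pair $(G,H)$ is dense if $G$ is connected and for every $v\in V(G)$ and every integer $i$ with $0\le i\le d_G(v)-1$: if $i\notin H(v)$ then $i+1\in H(v)$. $[s,t]=\{s,\dots,t\}$. -}

module Defs where

open import Data.Nat using (ℕ; zero; suc; _+_; _<_; _≤_)
open import Data.Nat.Divisibility using (_∣_)
open import Data.Fin using (Fin; zero; suc)
open import Data.Bool using (Bool; true; false; if_then_else_)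
open import Data.Product using (Σ; ∃; ∃-syntax; _×_; _,_; proj₁; proj₂)
open import Data.Sum using (_⊎_)
open import Relation.Binary.PropositionalEquality using (_≡_; _≢_)
open import Relation.Nullary using (¬_; does)
open import Data.Fin using (_≟_)
open import Data.Unit using (⊤)

-- A finite loopless multigraph: vertices Fin n, edges Fin m, each edge e
-- has two distinct ends (ends e). Parallel edges are allowed.
record Graph : Set where
  field
    n     : ℕ
    m     : ℕ
    ends  : Fin m → Fin n × Fin n
    loopless : ∀ e → proj₁ (ends e) ≢ proj₂ (ends e)

open Graph public

count : (k : ℕ) → (Fin k → Bool) → ℕ
count zero    p = 0
count (suc k) p = (if p zero then 1 else 0) + count k (λ i → p (suc i))

_=ᵇ_ : ∀ {k} → Fin k → Fin k → Bool
a =ᵇ b = does (a ≟ b)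

deg : (G : Graph) → Fin (n G) → ℕ
deg G v = count (m G) (λ e → if proj₁ (ends G e) =ᵇ v then true else (proj₂ (ends G e) =ᵇ v))

-- An orientation: for each edge e with ends (a , b), true means a → b,
-- false means b → a.
Orientation : Graph → Set
Orientation G = Fin (m G) → Bool

tail : (G : Graph) → Orientation G → Fin (m G) → Fin (n G)
tail G O e = if O e then proj₁ (ends G e) else proj₂ (ends G e)

outdeg : (G : Graph) → Orientation G → Fin (n G) → ℕ
outdeg G O v = count (m G) (λ e → tail G O e =ᵇ v)

-- H : V(G) → 2^ℕ, represented by characteristic (decidable) functions
Prescription : Graph → Set
Prescription G = Fin (n G) → ℕ → Bool

IsHOrientation : (G : Graph) → Prescription G → Orientation G → Set
IsHOrientation G H O = ∀ v → H v (outdeg G O v) ≡ true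

HasHOrientation : (G : Graph) → Prescription G → Set
HasHOrientation G H = Σ (Orientation G) (IsHOrientation G H)

Adjacent : (G : Graph) → Fin (n G) → Fin (n G) → Set
Adjacent G u v = ∃[ e ] (ends G e ≡ (u , v) ⊎ ends G e ≡ (v , u))

data ReachIn (G : Graph) (P : Fin (n G) → Set) : Fin (n G) → Fin (n G) → Set where
  here : ∀ {u} → P u → ReachIn G P u u
  step : ∀ {u w v} → P u → Adjacent G u w → ReachIn G P w v → ReachIn G P u v

Everywhere : ∀ {A : Set} → A → Set
Everywhere _ = ⊤

Connected : Graph → Set
Connected G = ∀ u v → ReachIn G Everywhere u v

-- x is a cut vertex: deleting x disconnects two vertices u, v ≠ x that are
-- connected in G (i.e. G - x has more components than G).
CutVertex : (G : Graph) → Fin (n G) → Set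
CutVertex G x = ∃[ u ] ∃[ v ] (u ≢ x × v ≢ x × ReachIn G Everywhere u v
                              × ¬ ReachIn G (λ w → w ≢ x) u v)

Dense : (G : Graph) → Prescription G → Set
Dense G H = Connected G ×
  (∀ v i → i < deg G v → H v i ≡ false → H v (suc i) ≡ true)

FixedParity : (G : Graph) → Prescription G → Fin (n G) → Set
FixedParity G H x =
    (∀ i → H x i ≡ true → i ≤ deg G x → 2 ∣ i)
  ⊎ (∀ i → H x i ≡ true → i ≤ deg G x → ¬ (2 ∣ i))

-- If H(x) ∩ [0, d(x)] contains two consecutive values k, k + 1, pick an edge e = xy and
-- orient exactly k of the other edges at x out of x: then x is satisfied whichever way e
-- is oriented. Among such orientations take one with fewest unsatisfied vertices. An
-- unsatisfied vertex v ≠ x is joined to y by a walk avoiding x, as x is not a cut vertex;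
-- reorienting the walk's edges one at a time satisfies every vertex on it (each edge is
-- turned so that its first end is satisfied, which density makes possible), and e finally
-- serves y. This leaves fewer unsatisfied vertices, so in fact there is an H-orientation.
-- Without two consecutive values, density forces H(x) to alternate on [0, d(x)].
module Submission where

open import Data.Bool using (Bool; true; false; not; if_then_else_)
import Data.Bool.Properties as Bool
open import Data.Empty using (⊥; ⊥-elim)
open import Data.Fin using (Fin; zero; suc; toℕ; fromℕ<; _≟_)
open import Data.Fin.Properties using (any?; suc-injective; toℕ<n; toℕ-fromℕ<)
open import Data.Nat using (ℕ; zero; suc; _+_; _≤_; _<_; z≤n; s≤s)
open import Data.Nat.Divisibility using (_∣_; _∣0; ∣-refl; ∣m∣n⇒∣m+n; ∣m+n∣m⇒∣n; ∣1⇒≡1)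
open import Data.Nat.Induction using (<-wellFounded)
open import Data.Nat.Properties using (≤-trans; ≤-pred; m+n≤o⇒n≤o; +-suc; +-mono-≤; +-mono-≤-<)
open import Data.Product using (∃; _×_; _,_; proj₁; proj₂)
open import Data.Sum using (_⊎_; inj₁; inj₂)
open import Data.Vec.Functional using (updateAt; _∷_)
open import Data.Vec.Functional.Properties
  using (updateAt-updates; updateAt-minimal; updateAt-id-local; updateAt-updateAt; updateAt-commutes)
open import Function using (_∘_; const)
open import Induction.WellFounded using (Acc; acc)
open import Relation.Binary.PropositionalEquality
open import Relation.Nullary using (¬_; Dec; yes; no)
open import Relation.Nullary.Decidable using (dec-true; dec-false; _×-dec_; _⊎-dec_)

open import Defs

count-cong : ∀ k {p q : Fin k → Bool} → (∀ i → p i ≡ q i) → count k p ≡ count k q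
count-cong zero    p≗q = refl
count-cong (suc k) p≗q rewrite p≗q zero = cong₂ _+_ refl (count-cong k (p≗q ∘ suc))

count-cong-off : ∀ k {p q : Fin k → Bool} (f : Fin k) → (∀ i → i ≢ f → p i ≡ q i) →
                 p f ≡ q f → count k p ≡ count k q
count-cong-off k {p} {q} f agree pf≡qf = count-cong k pointwise
  where
    pointwise : ∀ i → p i ≡ q i
    pointwise i with i ≟ f
    ... | yes refl = pf≡qf
    ... | no i≢f   = agree i i≢f

count-insert : ∀ k {p q : Fin k → Bool} (f : Fin k) → (∀ i → i ≢ f → p i ≡ q i) →
               p f ≡ false → q f ≡ true → count k q ≡ suc (count k p)
count-insert (suc k) zero agree pf qf rewrite pf | qf =
  sym (cong suc (count-cong k (λ i → agree (suc i) λ ())))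
count-insert (suc k) (suc f) agree pf qf rewrite agree zero (λ ()) =
  trans (cong₂ _+_ refl (count-insert k f (λ i i≢f → agree (suc i) (i≢f ∘ suc-injective)) pf qf))
        (+-suc _ _)

count-add : ∀ k {p q : Fin k → Bool} (f : Fin k) → (∀ i → i ≢ f → p i ≡ q i) →
            p f ≡ false → count k q ≡ (if q f then 1 else 0) + count k p
count-add k {q = q} f agree pf with q f in qf
... | true  = count-insert k f agree pf qf
... | false = sym (count-cong-off k f agree (trans pf (sym qf)))

indicator-mono : ∀ {b c : Bool} → (b ≡ true → c ≡ true) →
                 (if b then 1 else 0) ≤ (if c then 1 else 0)
indicator-mono {false} b⇒c = z≤n
indicator-mono {true}  b⇒c rewrite b⇒c refl = s≤s z≤n

count-mono-≤ : ∀ k {p q : Fin k → Bool} → (∀ i → p i ≡ true → q i ≡ true) →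
               count k p ≤ count k q
count-mono-≤ zero    p⊆q = z≤n
count-mono-≤ (suc k) p⊆q = +-mono-≤ (indicator-mono (p⊆q zero)) (count-mono-≤ k (p⊆q ∘ suc))

count-mono-< : ∀ k {p q : Fin k → Bool} → (∀ i → p i ≡ true → q i ≡ true) →
               (f : Fin k) → p f ≡ false → q f ≡ true → count k p < count k q
count-mono-< (suc k) p⊆q zero pf qf rewrite pf | qf = s≤s (count-mono-≤ k (p⊆q ∘ suc))
count-mono-< (suc k) p⊆q (suc f) pf qf =
  +-mono-≤-< (indicator-mono (p⊆q zero)) (count-mono-< k (p⊆q ∘ suc) f pf qf)

count-find : ∀ k (p : Fin k → Bool) → 0 < count k p → ∃ λ i → p i ≡ true
count-find (suc k) p pos with p zero in p0
... | true  = zero , p0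
... | false = let i , pi = count-find k (p ∘ suc) pos in suc i , pi

private
  SubsetOfSize : ∀ k → (Fin k → Bool) → ℕ → Set
  SubsetOfSize k q t = ∃ λ s → (∀ i → s i ≡ true → q i ≡ true) × count k s ≡ t

  extend : ∀ {k} {q : Fin (suc k) → Bool} {t} b → SubsetOfSize k (q ∘ suc) t →
           (b ≡ true → q zero ≡ true) → SubsetOfSize (suc k) q ((if b then 1 else 0) + t)
  extend b (s , s⊆q , refl) b⇒q = b ∷ s , (λ { zero → b⇒q ; (suc i) → s⊆q i }) , refl

count-sub : ∀ k (q : Fin k → Bool) t → t ≤ count k q → SubsetOfSize k q t
count-sub zero    q zero    z≤n = (λ ()) , (λ ()) , refl
count-sub (suc k) q t       t≤  with q zero in q0
count-sub (suc k) q t       t≤       | false = extend false (count-sub k (q ∘ suc) t t≤) (λ ())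
count-sub (suc k) q zero    _        | true  = extend false (count-sub k (q ∘ suc) 0 z≤n) (λ ())
count-sub (suc k) q (suc t) (s≤s t≤) | true  = extend true  (count-sub k (q ∘ suc) t t≤) (λ _ → q0)

=ᵇ⇒≡ : ∀ {k} {a b : Fin k} → (a =ᵇ b) ≡ true → a ≡ b
=ᵇ⇒≡ {a = a} {b} eq with a ≟ b
... | yes a≡b = a≡b

DenseAt : (G : Graph) → Prescription G → Fin (n G) → Set
DenseAt G H v = ∀ i → i < deg G v → H v i ≡ false → H v (suc i) ≡ true

module _ (G : Graph) where

  private
    V : Set
    V = Fin (n G)

    E : Set
    E = Fin (m G)

  end : E → Bool → V
  end f b = if b then proj₁ (ends G f) else proj₂ (ends G f)

  incident : E → V → Bool
  incident f v = if proj₁ (ends G f) =ᵇ v then true else (proj₂ (ends G f) =ᵇ v)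

  OutAt : Orientation G → V → E → Bool
  OutAt O v f = tail G O f =ᵇ v

  Joins : E → V → V → Set
  Joins f u w = ends G f ≡ (u , w) ⊎ ends G f ≡ (w , u)

  reorient : Orientation G → E → Bool → Orientation G
  reorient O f b = updateAt O f (const b)

  joins-sym : ∀ {f u w} → Joins f u w → Joins f w u
  joins-sym (inj₁ eq) = inj₂ eq
  joins-sym (inj₂ eq) = inj₁ eq

  joins-end : ∀ {f u w} → Joins f u w → ∃ λ b → end f b ≡ u × end f (not b) ≡ w
  joins-end (inj₁ eq) = true  , cong proj₁ eq , cong proj₂ eq
  joins-end (inj₂ eq) = false , cong proj₂ eq , cong proj₁ eq

  joins-avoid : ∀ {f u w z} → Joins f u w → u ≢ z → w ≢ z → ∀ b → end f b ≢ z
  joins-avoid (inj₁ eq) u≢z w≢z true  = u≢z ∘ trans (sym (cong proj₁ eq))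
  joins-avoid (inj₁ eq) u≢z w≢z false = w≢z ∘ trans (sym (cong proj₂ eq))
  joins-avoid (inj₂ eq) u≢z w≢z true  = w≢z ∘ trans (sym (cong proj₁ eq))
  joins-avoid (inj₂ eq) u≢z w≢z false = u≢z ∘ trans (sym (cong proj₂ eq))

  joins-distinct : ∀ {f u w} → Joins f u w → u ≢ w
  joins-distinct (inj₁ refl) = loopless G _
  joins-distinct (inj₂ refl) = loopless G _ ∘ sym

  incident-joins : ∀ {f v} → incident f v ≡ true → ∃ λ w → Joins f v w
  incident-joins {f} {v} inc with proj₁ (ends G f) =ᵇ v in first
  ... | true  = proj₂ (ends G f) , inj₁ (cong (_, _) (=ᵇ⇒≡ first))
  ... | false = proj₁ (ends G f) , inj₂ (cong (_ ,_) (=ᵇ⇒≡ inc))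

  end-incident : ∀ f b {v} → end f b ≡ v → incident f v ≡ true
  end-incident f true  {v} eq rewrite dec-true (proj₁ (ends G f) ≟ v) eq = refl
  end-incident f false {v} eq with proj₁ (ends G f) =ᵇ v
  ... | true  = refl
  ... | false = dec-true (proj₂ (ends G f) ≟ v) eq

  out-incident : ∀ O v f → OutAt O v f ≡ true → incident f v ≡ true
  out-incident O v f out = end-incident f (O f) (=ᵇ⇒≡ out)

  tail-reorient : ∀ O f b → tail G (reorient O f b) f ≡ end f b
  tail-reorient O f b = cong (end f) (updateAt-updates f O)

  outdeg-cong : ∀ {O O'} v → (∀ f → O f ≡ O' f) → outdeg G O v ≡ outdeg G O' v
  outdeg-cong v O≗O' = count-cong (m G) (λ f → cong (λ b → end f b =ᵇ v) (O≗O' f))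

  OutAt-reorient-off : ∀ O f b v i → i ≢ f → OutAt (reorient O f b) v i ≡ OutAt O v i
  OutAt-reorient-off O f b v i i≢f = cong (λ c → end i c =ᵇ v) (updateAt-minimal i f O i≢f)

  outdeg-reorient-away : ∀ {f u w z} O b → Joins f u w → u ≢ z → w ≢ z →
                         outdeg G (reorient O f b) z ≡ outdeg G O z
  outdeg-reorient-away {f} {z = z} O b f-joins u≢z w≢z =
    count-cong-off (m G) f (λ i → OutAt-reorient-off O f b z i)
      (trans (dec-false (_ ≟ z) (avoid (reorient O f b f))) (sym (dec-false (_ ≟ z) (avoid (O f)))))
    where
      avoid : ∀ b → end f b ≢ z
      avoid = joins-avoid f-joins u≢z w≢z

  outdeg-reorient-suc : ∀ O f b {u} → end f b ≡ u → end f (not b) ≢ u →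
                        outdeg G (reorient O f b) u ≡ suc (outdeg G (reorient O f (not b)) u)
  outdeg-reorient-suc O f b {u} u-end other≢u =
    count-insert (m G) f
      (λ i i≢f → trans (OutAt-reorient-off O f (not b) u i i≢f) (sym (OutAt-reorient-off O f b u i i≢f)))
      (dec-false (_ ≟ u) (other≢u ∘ trans (sym (tail-reorient O f (not b)))))
      (dec-true (_ ≟ u) (trans (tail-reorient O f b) u-end))

  outdeg<deg : ∀ O {f v} → incident f v ≡ true → OutAt O v f ≡ false → outdeg G O v < deg G v
  outdeg<deg O {f} {v} inc not-out = count-mono-< (m G) (out-incident O v) f not-out inc

  orient-out-exactly : ∀ v (s : E → Bool) → (∀ f → s f ≡ true → incident f v ≡ true) →
                       ∃ λ O → ∀ f → OutAt O v f ≡ s f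
  orient-out-exactly v s s⊆incident = O , out
    where
      O : Orientation G
      O f = if s f then (proj₁ (ends G f) =ᵇ v) else not (proj₁ (ends G f) =ᵇ v)

      out : ∀ f → OutAt O v f ≡ s f
      out f with s f in sf | proj₁ (ends G f) =ᵇ v in first
      ... | true  | true  = first
      ... | true  | false =
        subst (λ c → (if c then true else (proj₂ (ends G f) =ᵇ v)) ≡ true) first (s⊆incident f sf)
      ... | false | true  =
        dec-false (_ ≟ v) (λ second → loopless G f (trans (=ᵇ⇒≡ first) (sym second)))
      ... | false | false = first

  out-set-avoiding : ∀ {e v} → incident e v ≡ true → ∀ k → suc k ≤ deg G v →
    ∃ λ s → (∀ f → s f ≡ true → incident f v ≡ true) × s e ≡ false × count (m G) s ≡ k
  out-set-avoiding {e} {v} e-incident k k<deg =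
    let s , s⊆others , ∣s∣ = count-sub (m G) others k (≤-pred (subst (suc k ≤_) deg≡ k<deg)) in
    s , (λ f → others⊆incident f ∘ s⊆others f) , Bool.¬-not (others-e ∘ s⊆others e) , ∣s∣
    where
      others : E → Bool
      others = updateAt (λ f → incident f v) e (const false)

      others-e : others e ≢ true
      others-e eq with () ← trans (sym (updateAt-updates e _)) eq

      others⊆incident : ∀ f → others f ≡ true → incident f v ≡ true
      others⊆incident f eq with f ≟ e
      ... | yes refl = ⊥-elim (others-e eq)
      ... | no f≢e   = trans (sym (updateAt-minimal f e _ f≢e)) eq

      deg≡ : deg G v ≡ suc (count (m G) others)
      deg≡ = count-insert (m G) e (λ f f≢e → updateAt-minimal f e _ f≢e) (updateAt-updates e _) e-incident

  module _ (H : Prescription G) where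

    Satisfied : Orientation G → V → Set
    Satisfied O v = H v (outdeg G O v) ≡ true

    satisfiable-at-end : ∀ {f u} → DenseAt G H u → ∀ O b → end f b ≡ u → end f (not b) ≢ u →
                         ∃ λ b' → Satisfied (reorient O f b') u
    satisfiable-at-end {f} {u} dense O b u-end other≢u
      with H u (outdeg G (reorient O f (not b)) u) in ok
    ... | true  = not b , ok
    ... | false = b , trans (cong (H u) (outdeg-reorient-suc O f b u-end other≢u)) (dense _ below ok)
      where
        below : outdeg G (reorient O f (not b)) u < deg G u
        below = outdeg<deg (reorient O f (not b)) (end-incident f b u-end)
                  (dec-false (_ ≟ u) (other≢u ∘ trans (sym (tail-reorient O f (not b)))))

    satisfiable-by-reorienting : ∀ {f u w} → DenseAt G H u → Joins f u w → ∀ O →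
                                 ∃ λ b → Satisfied (reorient O f b) u
    satisfiable-by-reorienting dense f-joins O =
      let b , u-end , w-end = joins-end f-joins in
      satisfiable-at-end dense O b u-end
        (joins-distinct (joins-sym f-joins) ∘ trans (sym w-end))

OnWalk : ∀ {G P u v} → ReachIn G P u v → Fin (n G) → Set
OnWalk (here {u} _)     z = z ≡ u
OnWalk (step {u} _ _ r) z = z ≡ u ⊎ OnWalk r z

onWalk? : ∀ {G P u v} (r : ReachIn G P u v) z → Dec (OnWalk r z)
onWalk? (here {u} _)     z = z ≟ u
onWalk? (step {u} _ _ r) z = (z ≟ u) ⊎-dec onWalk? r z

start-onWalk : ∀ {G P u v} (r : ReachIn G P u v) → OnWalk r u
start-onWalk (here _)     = refl
start-onWalk (step _ _ _) = inj₁ refl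

start-satisfies : ∀ {G P u v} → ReachIn G P u v → P u
start-satisfies (here pu)     = pu
start-satisfies (step pu _ _) = pu

module Repair (G : Graph) (H : Prescription G) (dense : ∀ v → DenseAt G H v)
              {x y : Fin (n G)} {e : Fin (m G)} (e-joins : Joins G e x y) where

  Flexible : Orientation G → Set
  Flexible O = ∀ b → Satisfied G H (reorient G O e b) x

  flexible⇒satisfied : ∀ {O} → Flexible O → Satisfied G H O x
  flexible⇒satisfied {O} flex =
    trans (cong (H x) (sym (outdeg-cong G x (updateAt-id-local e O refl)))) (flex (O e))

  flexible-reorient-e : ∀ {O} b → Flexible O → Flexible (reorient G O e b)
  flexible-reorient-e {O} b flex b' =
    trans (cong (H x) (outdeg-cong G x (updateAt-updateAt e O))) (flex b')

  flexible-reorient-away : ∀ {O f u w} b → Joins G f u w → u ≢ x → w ≢ x →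
                           Flexible O → Flexible (reorient G O f b)
  flexible-reorient-away {O} {f} b f-joins u≢x w≢x flex b' =
    trans (cong (H x) (trans (outdeg-cong G x (updateAt-commutes e f e≢f O))
                             (outdeg-reorient-away G _ b f-joins u≢x w≢x)))
          (flex b')
    where
      e≢f : e ≢ f
      e≢f refl = let b , x-end , _ = joins-end G e-joins in joins-avoid G f-joins u≢x w≢x b x-end

  repair-along : ∀ {u} (r : ReachIn G (_≢ x) u y) O → Flexible O →
    ∃ λ O' → Flexible O' × (∀ z → OnWalk r z → Satisfied G H O' z)
                         × (∀ z → z ≢ x → ¬ OnWalk r z → outdeg G O' z ≡ outdeg G O z)
  repair-along (here _) O flex =
    let b , y-good = satisfiable-by-reorienting G H (dense y) (joins-sym G e-joins) O in
    reorient G O e b , flexible-reorient-e b flex , (λ { z refl → y-good }) ,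
    λ z z≢x z≢y → outdeg-reorient-away G O b e-joins (z≢x ∘ sym) (z≢y ∘ sym)
  repair-along (step {u} {w} u≢x (f , f-joins) r) O flex
    with satisfiable-by-reorienting G H (dense u) f-joins O
  ... | b , u-good
    with repair-along r (reorient G O f b)
           (flexible-reorient-away b f-joins u≢x (start-satisfies r) flex)
  ... | O' , flex' , good' , same' = O' , flex' , good , same
    where
      good : ∀ z → z ≡ u ⊎ OnWalk r z → Satisfied G H O' z
      good z (inj₂ z∈r) = good' z z∈r
      good z (inj₁ refl) with onWalk? r z
      ... | yes z∈r = good' z z∈r
      ... | no z∉r  = trans (cong (H u) (same' u u≢x z∉r)) u-good

      same : ∀ z → z ≢ x → ¬ (z ≡ u ⊎ OnWalk r z) → outdeg G O' z ≡ outdeg G O z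
      same z z≢x z∉ = trans (same' z z≢x (z∉ ∘ inj₂))
        (outdeg-reorient-away G O b f-joins (z∉ ∘ inj₁ ∘ sym)
                                            (λ w≡z → z∉ (inj₂ (subst (OnWalk r) w≡z (start-onWalk r)))))

  flexible-from-consecutive : ∀ k → H x k ≡ true → H x (suc k) ≡ true → suc k ≤ deg G x →
                              ∃ Flexible
  flexible-from-consecutive k k∈H 1+k∈H k<deg =
    let b , x-end , _  = joins-end G e-joins
        s , s⊆incident , s-e , ∣s∣ = out-set-avoiding G (end-incident G e b x-end) k k<deg
        O , out = orient-out-exactly G x s s⊆incident
    in O , flexible O s out s-e ∣s∣
    where
      flexible : ∀ O s → (∀ f → OutAt G O x f ≡ s f) → s e ≡ false → count (m G) s ≡ k → Flexible O
      flexible O s out s-e refl b =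
        trans (cong (H x) (count-add (m G) e agree s-e))
              (either-way (OutAt G (reorient G O e b) x e))
        where
          agree : ∀ f → f ≢ e → s f ≡ OutAt G (reorient G O e b) x f
          agree f f≢e = trans (sym (out f)) (sym (OutAt-reorient-off G O e b x f f≢e))

          either-way : ∀ t → H x ((if t then 1 else 0) + count (m G) s) ≡ true
          either-way true  = 1+k∈H
          either-way false = k∈H

  unsatisfied : Orientation G → Fin (n G) → Bool
  unsatisfied O v = not (H v (outdeg G O v))

  unsatisfied-anti : ∀ {O O'} → (∀ z → Satisfied G H O z → Satisfied G H O' z) →
                     ∀ z → unsatisfied O' z ≡ true → unsatisfied O z ≡ true
  unsatisfied-anti {O} better z with H z (outdeg G O z) in ok
  ... | false = λ _ → refl
  ... | true rewrite better z ok = λ ()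

  module _ (connected : Connected G) (x-not-cut : ¬ CutVertex G x)
           (no-orientation : ¬ HasHOrientation G H) where

    no-flexible-orientation : ∀ O → Flexible O → ⊥
    no-flexible-orientation O = descend O (<-wellFounded _)
      where
        descend : ∀ O → Acc _<_ (count (n G) (unsatisfied O)) → Flexible O → ⊥
        descend O (acc smaller) flex with any? (λ v → H v (outdeg G O v) Bool.≟ false)
        ... | no none = no-orientation (O , λ v → Bool.¬-not (none ∘ (v ,_)))
        ... | yes (v , v-bad) =
          x-not-cut (v , y , v≢x , joins-distinct G (joins-sym G e-joins) , connected v y , no-walk)
          where
            v≢x : v ≢ x
            v≢x refl with () ← trans (sym (flexible⇒satisfied flex)) v-bad

            no-walk : ¬ ReachIn G (_≢ x) v y
            no-walk r with repair-along r O flex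
            ... | O' , flex' , good' , same' = descend O' (smaller fewer) flex'
              where
                better : ∀ z → Satisfied G H O z → Satisfied G H O' z
                better z z-good with onWalk? r z | z ≟ x
                ... | yes z∈r | _        = good' z z∈r
                ... | no _    | yes refl = flexible⇒satisfied flex'
                ... | no z∉r  | no z≢x   = trans (cong (H z) (same' z z≢x z∉r)) z-good

                fewer : count (n G) (unsatisfied O') < count (n G) (unsatisfied O)
                fewer = count-mono-< (n G) (unsatisfied-anti {O} {O'} better) v
                          (cong not (good' v (start-onWalk r))) (cong not v-bad)

module _ (b : ℕ → Bool) (d : ℕ) where

  Consecutive : Set
  Consecutive = ∃ λ (k : Fin d) → b (toℕ k) ≡ true × b (suc (toℕ k)) ≡ true

  consecutive? : Dec Consecutive
  consecutive? = any? (λ k → (b (toℕ k) Bool.≟ true) ×-dec (b (suc (toℕ k)) Bool.≟ true))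

  alternating : ¬ Consecutive → (∀ i → i < d → b i ≡ false → b (suc i) ≡ true) →
                ∀ i → i < d → b (suc i) ≡ not (b i)
  alternating none dense i i<d with b i in bi
  ... | false = dense i i<d bi
  ... | true  = Bool.¬-not λ bsi →
    none (fromℕ< i<d , subst (λ j → b j ≡ true × b (suc j) ≡ true) (sym (toℕ-fromℕ< i<d)) (bi , bsi))

module _ {b : ℕ → Bool} {d : ℕ} (alternates : ∀ i → i < d → b (suc i) ≡ not (b i)) where

  two-apart : ∀ i → 2 + i ≤ d → b (2 + i) ≡ b i
  two-apart i le = begin
    b (2 + i)       ≡⟨ alternates (suc i) le ⟩
    not (b (1 + i)) ≡⟨ cong not (alternates i (m+n≤o⇒n≤o 1 le)) ⟩
    not (not (b i)) ≡⟨ Bool.not-involutive (b i) ⟩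
    b i             ∎
    where open ≡-Reasoning

  even-if-starting-true : b 0 ≡ true → ∀ i → b i ≡ true → i ≤ d → 2 ∣ i
  even-if-starting-true b0 zero          _  _   = 2 ∣0
  even-if-starting-true b0 (suc zero)    b1 1≤d
    with () ← trans (sym b1) (trans (alternates 0 1≤d) (cong not b0))
  even-if-starting-true b0 (suc (suc i)) bi le  =
    ∣m∣n⇒∣m+n ∣-refl (even-if-starting-true b0 i (trans (sym (two-apart i le)) bi) (m+n≤o⇒n≤o 2 le))

  odd-if-starting-false : b 0 ≡ false → ∀ i → b i ≡ true → i ≤ d → ¬ 2 ∣ i
  odd-if-starting-false b0 zero          b0' _  _   with () ← trans (sym b0) b0'
  odd-if-starting-false b0 (suc zero)    _   _  2∣1 with () ← ∣1⇒≡1 2∣1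
  odd-if-starting-false b0 (suc (suc i)) bi  le 2∣i+2 =
    odd-if-starting-false b0 i (trans (sym (two-apart i le)) bi) (m+n≤o⇒n≤o 2 le)
                          (∣m+n∣m⇒∣n 2∣i+2 ∣-refl)

alternating⇒fixedParity : ∀ G H x → (∀ i → i < deg G x → H x (suc i) ≡ not (H x i)) →
                          FixedParity G H x
alternating⇒fixedParity G H x alternates with H x 0 in h0
... | true  = inj₁ (even-if-starting-true alternates h0)
... | false = inj₂ (odd-if-starting-false alternates h0)

lemma2p4 : (G : Graph) (H : Prescription G) → Dense G H → ¬ HasHOrientation G H →
    ∀ (x : Fin (n G)) → ¬ CutVertex G x → FixedParity G H x
lemma2p4 G H (connected , dense) no-orientation x x-not-cut
  with consecutive? (H x) (deg G x)
... | no none = alternating⇒fixedParity G H x (alternating (H x) (deg G x) none (dense x))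
... | yes (k , k∈H , 1+k∈H)
  with count-find (m G) (λ f → incident G f x) (≤-trans (s≤s z≤n) (toℕ<n k))
... | e , e-incident
  with incident-joins G e-incident
... | y , e-joins =
  let O , flex = flexible-from-consecutive (toℕ k) k∈H 1+k∈H (toℕ<n k) in
  ⊥-elim (no-flexible-orientation connected x-not-cut no-orientation O flex)
  where open Repair G H dense e-joins
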